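{- Let $R$ be a finite associative principal ideal ring with unity (every left ideal and every right ideal of $R$ is principal) and $(a,b)\in{}^2\!R$. Then $R(a,b)$ is a free cyclic submodule of ${}^2\!R$ if and only if $(a,b)$ is unimodular.
   Context: ${}^2\!R$ denotes the left $R$-module $R\times R$ with $\alpha(a,b)=(\alpha a,\alpha b)$; $R(a,b)=\{(\alpha a,\alpha b):\alpha\in R\}$ is a free cyclic submodule if $(\alpha a,\alpha b)=(0,0)$ implies $\alpha=0$. $(a,b)$ is unimodular if $aR+bR=\{ax+by:x,y\in R\}=R$. -}

module Defs where

open import Level using (Level; _⊔_; suc)
open import Algebra.Bundles using (Ring)
open import Data.Nat using (ℕ)
open import Data.Fin using (Fin)
open import Data.Product using (Σ; ∃; _×_; _,_)
open import Function.Bundles using (Inverse; _⇔_)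
open import Relation.Unary using (Pred)
import Relation.Binary.PropositionalEquality as ≡

module _ {c ℓ : Level} (R : Ring c ℓ) where
  open Ring R

  IsFiniteRing : Set (c ⊔ ℓ)
  IsFiniteRing = ∃ λ (n : ℕ) → Inverse setoid (≡.setoid (Fin n))

  record IsLeftIdeal (I : Pred Carrier (c ⊔ ℓ)) : Set (c ⊔ ℓ) where
    field
      resp  : ∀ {x y} → x ≈ y → I x → I y
      zero∈ : I 0#
      +∈    : ∀ {x y} → I x → I y → I (x + y)
      *∈    : ∀ r {x} → I x → I (r * x)

  record IsRightIdeal (I : Pred Carrier (c ⊔ ℓ)) : Set (c ⊔ ℓ) where
    field
      resp  : ∀ {x y} → x ≈ y → I x → I y
      zero∈ : I 0#
      +∈    : ∀ {x y} → I x → I y → I (x + y)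
      *∈    : ∀ r {x} → I x → I (x * r)

  IsPrincipalLeft : Pred Carrier (c ⊔ ℓ) → Set (c ⊔ ℓ)
  IsPrincipalLeft I = ∃ λ g → ∀ x → I x ⇔ (∃ λ r → x ≈ r * g)

  IsPrincipalRight : Pred Carrier (c ⊔ ℓ) → Set (c ⊔ ℓ)
  IsPrincipalRight I = ∃ λ g → ∀ x → I x ⇔ (∃ λ r → x ≈ g * r)

  IsPrincipalIdealRing : Set (suc (c ⊔ ℓ))
  IsPrincipalIdealRing =
    (∀ I → IsLeftIdeal I → IsPrincipalLeft I) ×
    (∀ I → IsRightIdeal I → IsPrincipalRight I)

  -- R(a,b) is a free cyclic submodule of ²R: (αa, αb) = (0,0) implies α = 0
  IsFreeCyclic : Carrier → Carrier → Set (c ⊔ ℓ)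
  IsFreeCyclic a b = ∀ α → α * a ≈ 0# → α * b ≈ 0# → α ≈ 0#

  -- (a,b) unimodular: aR + bR = R, i.e. every element is of form ax + by
  IsUnimodular : Carrier → Carrier → Set (c ⊔ ℓ)
  IsUnimodular a b = ∀ z → ∃ λ x → ∃ λ y → a * x + b * y ≈ z

module Submission where

-- Unimodular ⇒ free holds in every ring: writing 1 = ax + by, any α with
-- αa = αb = 0 satisfies α = α(ax + by) = 0.
--
-- Free ⇒ unimodular: aR + bR is a right ideal, hence equals dR for some d.
-- As a, b ∈ dR, every α with αd = 0 kills a and b, so α = 0 by freeness:
-- d has trivial left annihilator.  In a finite ring such an element has a
-- right inverse (x ↦ xd is injective, hence by pigeonhole surjective, giving
-- ed = 1; then y ↦ dy is injective, hence surjective, giving dt = 1), and a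
-- right ideal containing a right-invertible element is all of R.

open import Defs
open import Level using (Level; _⊔_)
open import Algebra.Bundles using (Ring)
open import Function.Bundles using (_⇔_; mk⇔; Inverse; Equivalence)
open import Function.Definitions using (Injective)
open import Data.Nat using (suc)
open import Data.Nat.Properties using (1+n≰n)
open import Data.Fin using (Fin; punchOut)
open import Data.Fin.Properties using (any?; _≟_; punchOut-injective; injective⇒≤)
open import Data.Product using (∃; _,_; proj₁; proj₂)
open import Relation.Nullary using (yes; no)
open import Relation.Nullary.Negation using (contradiction)
open import Relation.Binary.PropositionalEquality as ≡ using (_≡_; _≢_)

-- Pigeonhole: an injective map Fin n → Fin n is surjective.  If y were
-- missed, punching y out would give an injection Fin (suc m) → Fin m.
fin-injective⇒surjective : ∀ n (f : Fin n → Fin n) → Injective _≡_ _≡_ f →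
                           ∀ y → ∃ λ x → f x ≡ y
fin-injective⇒surjective (suc m) f f-inj y with any? (λ x → f x ≟ y)
... | yes hit = hit
... | no  miss = contradiction (injective⇒≤ squeeze-inj) 1+n≰n
  where
  y≢f : ∀ x → y ≢ f x
  y≢f x y≡fx = miss (x , ≡.sym y≡fx)

  squeeze : Fin (suc m) → Fin m
  squeeze x = punchOut (y≢f x)

  squeeze-inj : Injective _≡_ _≡_ squeeze
  squeeze-inj eq = f-inj (punchOut-injective (y≢f _) (y≢f _) eq)

module _ {c ℓ : Level} (R : Ring c ℓ) where
  open Ring R
  open import Algebra.Properties.Ring R using ([y-z]x≈yx-zx; x∙y⁻¹≈ε⇒x≈y; x≈y⇒x∙y⁻¹≈ε)
  open import Algebra.Properties.CommutativeSemigroup +-commutativeSemigroup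
    using (interchange)
  open import Relation.Binary.Reasoning.Setoid setoid

  finite-injective⇒surjective : IsFiniteRing R → (f : Carrier → Carrier) →
    (∀ {x y} → f x ≈ f y → x ≈ y) → ∀ y → ∃ λ x → f x ≈ y
  finite-injective⇒surjective (n , iso) f f-inj y =
    let x , gx≡y = fin-injective⇒surjective n g g-inj (to y)
    in  from x , (begin
          f (from x)              ≈⟨ strictlyInverseʳ _ ⟨
          from (to (f (from x)))  ≈⟨ from-cong gx≡y ⟩
          from (to y)             ≈⟨ strictlyInverseʳ y ⟩
          y                       ∎)
    where
    open Inverse iso

    g : Fin n → Fin n
    g i = to (f (from i))

    from-inj : ∀ {i j} → from i ≈ from j → i ≡ j
    from-inj {i} {j} eq = ≡.trans (≡.sym (strictlyInverseˡ i))
                                  (≡.trans (to-cong eq) (strictlyInverseˡ j))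

    g-inj : Injective _≡_ _≡_ g
    g-inj gi≡gj = from-inj (f-inj (begin
      f (from _)             ≈⟨ strictlyInverseʳ _ ⟨
      from (g _)             ≈⟨ from-cong gi≡gj ⟩
      from (g _)             ≈⟨ strictlyInverseʳ _ ⟩
      f (from _)             ∎))

  LeftRegular : Carrier → Set (c ⊔ ℓ)
  LeftRegular d = ∀ α → α * d ≈ 0# → α ≈ 0#

  leftRegular⇒rightCancel : ∀ {d} → LeftRegular d → ∀ {x y} → x * d ≈ y * d → x ≈ y
  leftRegular⇒rightCancel {d} reg {x} {y} xd≈yd = x∙y⁻¹≈ε⇒x≈y x y (reg (x - y) (begin
    (x - y) * d    ≈⟨ [y-z]x≈yx-zx d x y ⟩
    x * d - y * d  ≈⟨ x≈y⇒x∙y⁻¹≈ε xd≈yd ⟩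
    0#             ∎))

  leftInverse⇒leftCancel : ∀ {d e} → e * d ≈ 1# → ∀ {x y} → d * x ≈ d * y → x ≈ y
  leftInverse⇒leftCancel {d} {e} ed≈1 {x} {y} dx≈dy = begin
    x            ≈⟨ *-identityˡ x ⟨
    1# * x       ≈⟨ *-congʳ ed≈1 ⟨
    e * d * x    ≈⟨ *-assoc e d x ⟩
    e * (d * x)  ≈⟨ *-congˡ dx≈dy ⟩
    e * (d * y)  ≈⟨ *-assoc e d y ⟨
    e * d * y    ≈⟨ *-congʳ ed≈1 ⟩
    1# * y       ≈⟨ *-identityˡ y ⟩
    y            ∎

  -- In a finite ring a left-regular element has a right inverse: x ↦ xd is
  -- injective, so ed = 1 for some e; then y ↦ dy is injective, so dt = 1.
  finite-leftRegular⇒rightInvertible : IsFiniteRing R → ∀ {d} → LeftRegular d →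
                                       ∃ λ t → d * t ≈ 1#
  finite-leftRegular⇒rightInvertible fin {d} reg =
    let e , ed≈1 = finite-injective⇒surjective fin (_* d)
                     (leftRegular⇒rightCancel reg) 1#
    in  finite-injective⇒surjective fin (d *_)
          (leftInverse⇒leftCancel ed≈1) 1#

  unimodular⇒free : ∀ a b → IsUnimodular R a b → IsFreeCyclic R a b
  unimodular⇒free a b unimod α αa≈0 αb≈0 with x , y , ax+by≈1 ← unimod 1# = begin
    α                          ≈⟨ *-identityʳ α ⟨
    α * 1#                     ≈⟨ *-congˡ ax+by≈1 ⟨
    α * (a * x + b * y)        ≈⟨ distribˡ α _ _ ⟩
    α * (a * x) + α * (b * y)  ≈⟨ +-cong (*-assoc α a x) (*-assoc α b y) ⟨
    α * a * x + α * b * y      ≈⟨ +-cong (*-congʳ αa≈0) (*-congʳ αb≈0) ⟩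
    0# * x + 0# * y            ≈⟨ +-cong (zeroˡ x) (zeroˡ y) ⟩
    0# + 0#                    ≈⟨ +-identityˡ 0# ⟩
    0#                         ∎

  RightSpan : Carrier → Carrier → Carrier → Set (c ⊔ ℓ)
  RightSpan a b z = ∃ λ x → ∃ λ y → a * x + b * y ≈ z

  rightSpan-isRightIdeal : ∀ a b → IsRightIdeal R (RightSpan a b)
  rightSpan-isRightIdeal a b = record
    { resp  = λ { z≈z′ (x , y , eq) → x , y , trans eq z≈z′ }
    ; zero∈ = 0# , 0# , trans (+-cong (zeroʳ a) (zeroʳ b)) (+-identityˡ 0#)
    ; +∈    = λ { (x₁ , y₁ , eq₁) (x₂ , y₂ , eq₂) → x₁ + x₂ , y₁ + y₂ , (begin
        a * (x₁ + x₂) + b * (y₁ + y₂)          ≈⟨ +-cong (distribˡ a x₁ x₂) (distribˡ b y₁ y₂) ⟩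
        (a * x₁ + a * x₂) + (b * y₁ + b * y₂)  ≈⟨ interchange _ _ _ _ ⟩
        (a * x₁ + b * y₁) + (a * x₂ + b * y₂)  ≈⟨ +-cong eq₁ eq₂ ⟩
        _ + _                                  ∎) }
    ; *∈    = λ { r (x , y , eq) → x * r , y * r , (begin
        a * (x * r) + b * (y * r)  ≈⟨ +-cong (*-assoc a x r) (*-assoc b y r) ⟨
        a * x * r + b * y * r      ≈⟨ distribʳ r _ _ ⟨
        (a * x + b * y) * r        ≈⟨ *-congʳ eq ⟩
        _ * r                      ∎) }
    }

  a∈rightSpan : ∀ a b → RightSpan a b a
  a∈rightSpan a b = 1# , 0# , trans (+-cong (*-identityʳ a) (zeroʳ b)) (+-identityʳ a)

  b∈rightSpan : ∀ a b → RightSpan a b b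
  b∈rightSpan a b = 0# , 1# , trans (+-cong (zeroʳ a) (*-identityʳ b)) (+-identityˡ b)

  -- If a, b ∈ dR and R(a,b) is free, then d is left-regular: an α with
  -- αd = 0 annihilates every element of dR, in particular a and b.
  free⇒commonLeftFactor-leftRegular : ∀ {a b d} → IsFreeCyclic R a b →
    (∃ λ r → a ≈ d * r) → (∃ λ r → b ≈ d * r) → LeftRegular d
  free⇒commonLeftFactor-leftRegular {d = d} free (_ , a≈dr) (_ , b≈dr′) α αd≈0 =
    free α (kills a≈dr) (kills b≈dr′)
    where
    kills : ∀ {z r} → z ≈ d * r → α * z ≈ 0#
    kills {z} {r} z≈dr = begin
      α * z        ≈⟨ *-congˡ z≈dr ⟩
      α * (d * r)  ≈⟨ *-assoc α d r ⟨
      α * d * r    ≈⟨ *-congʳ αd≈0 ⟩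
      0# * r       ≈⟨ zeroˡ r ⟩
      0#           ∎

  -- Free ⇒ unimodular in a finite principal ideal ring: aR + bR = dR with d
  -- left-regular, hence dt = 1 for some t, and every z = d(tz) lies in dR.
  free⇒unimodular : IsFiniteRing R → IsPrincipalIdealRing R →
                    ∀ a b → IsFreeCyclic R a b → IsUnimodular R a b
  free⇒unimodular fin (_ , principalʳ) a b free z =
    from (membership z) (t * z , (begin
      z            ≈⟨ *-identityˡ z ⟨
      1# * z       ≈⟨ *-congʳ dt≈1 ⟨
      d * t * z    ≈⟨ *-assoc d t z ⟩
      d * (t * z)  ∎))
    where
    open Equivalence using (to; from)

    generator : IsPrincipalRight R (RightSpan a b)
    generator = principalʳ (RightSpan a b) (rightSpan-isRightIdeal a b)

    d : Carrier
    d = proj₁ generator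

    membership : ∀ z → RightSpan a b z ⇔ (∃ λ r → z ≈ d * r)
    membership = proj₂ generator

    d-leftRegular : LeftRegular d
    d-leftRegular = free⇒commonLeftFactor-leftRegular free
      (to (membership a) (a∈rightSpan a b)) (to (membership b) (b∈rightSpan a b))

    d-rightInverse : ∃ λ t → d * t ≈ 1#
    d-rightInverse = finite-leftRegular⇒rightInvertible fin d-leftRegular

    t : Carrier
    t = proj₁ d-rightInverse

    dt≈1 : d * t ≈ 1#
    dt≈1 = proj₂ d-rightInverse

mainTheorem9 : {c ℓ : Level} (R : Ring c ℓ) → IsFiniteRing R → IsPrincipalIdealRing R →
    (a b : Ring.Carrier R) → IsFreeCyclic R a b ⇔ IsUnimodular R a b
mainTheorem9 R fin pir a b = mk⇔ (free⇒unimodular R fin pir a b) (unimodular⇒free R a b)
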